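{- Let $G$ be a cubic $2$-connected planar graph on $n$ vertices with perfect matching $M$. Let $G_u,G_v$ be two vertex-disjoint copies of $G$ with isomorphism $u_j\mapsto v_j$, and let the matching be ordered as $M_u=\{(u_0,u'_0),\dots,(u_{n/2-1},u'_{n/2-1})\}$ in $G_u$ and correspondingly $M_v=\{(v_0,v'_0),\dots,(v_{n/2-1},v'_{n/2-1})\}$ in $G_v$. For $y\in\{u,v\}$ let $\hat G_y$ be obtained from $G_y$ by, for each $i$, deleting the edge $y_iy'_i$, adding new vertices $s,a,b,b',a',t$ (distinct for each $i$ and $y$) and edges $y_is,\ ty'_i,\ sa,\ ab,\ bb',\ b'a',\ a't,\ st,\ tb,\ ba',\ a'a,\ ab',\ b's$. Let $\hat G=\hat G_u\cup\hat G_v$ (disjoint union). Let $\tilde G$ be obtained from $\hat G$ by adding, for each $0\le i<n/2$, eight new vertices $m_i,n_i,p_i,q_i,m'_i,n'_i,p'_i,q'_i$ with the edges of a $K_4$ on $\{m_i,n_i,p_i,q_i\}$, a $K_4$ on $\{m'_i,n'_i,p'_i,q'_i\}$, the edges $q_ip'_i$ and $p_iq'_i$, and the edges $u'_im_i,\ u_{i+1}n'_i,\ v'_in_i,\ v_{i+1}m'_i$, where indices are taken modulo $n/2$. Then for every integer $p$, $\hat G$ has a vertex cover of size at most $p$ if and only if $\tilde G$ has a vertex cover of size at most $p+3n$.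
   Context: A vertex cover of a graph is a vertex set meeting every edge. -}

module Defs where

open import Data.Nat using (ℕ; zero; suc; _%_) renaming (_≤_ to _≤ℕ_)
open import Data.Nat.DivMod using (m%n<n)
open import Data.Integer using (ℤ; +_) renaming (_≤_ to _≤ℤ_)
open import Data.Rational using (ℚ; 0ℚ; 1ℚ) renaming (_+_ to _+ℚ_; _*_ to _*ℚ_; _-_ to _-ℚ_; _≤_ to _≤ℚ_)
open import Data.Fin using (Fin; toℕ; fromℕ<)
open import Data.Bool using (Bool; true; false; T; if_then_else_)
open import Data.List using (List; length; map; allFin)
open import Data.Nat.ListAction using (sum)
open import Data.List.Membership.Propositional using (_∈_)
open import Data.List.Relation.Unary.Unique.Propositional using (Unique)
open import Data.Product using (Σ; ∃; ∃-syntax; _×_; _,_)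
open import Data.Sum using (_⊎_; inj₁; inj₂)
open import Data.Unit using (⊤)
open import Function.Definitions using (Bijective)
open import Relation.Binary.PropositionalEquality using (_≡_; _≢_)
open import Relation.Nullary using (¬_)

IsSimple : ∀ {n} → (Fin n → Fin n → Bool) → Set
IsSimple {n} adj = (∀ x y → adj x y ≡ adj y x) × (∀ x → adj x x ≡ false)

degree : ∀ {n} → (Fin n → Fin n → Bool) → Fin n → ℕ
degree {n} adj x = sum (map (λ y → if adj x y then 1 else 0) (allFin n))

Cubic : ∀ {n} → (Fin n → Fin n → Bool) → Set
Cubic {n} adj = ∀ x → degree adj x ≡ 3

data Walk {n} (adj : Fin n → Fin n → Bool) (Allowed : Fin n → Set) : Fin n → Fin n → Set where
  here : ∀ {x} → Allowed x → Walk adj Allowed x x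
  step : ∀ {x y z} → Allowed x → T (adj x y) → Walk adj Allowed y z → Walk adj Allowed x z

Connected : ∀ {n} → (Fin n → Fin n → Bool) → Set
Connected {n} adj = ∀ x y → Walk adj (λ _ → ⊤) x y

TwoConnected : ∀ {n} → (Fin n → Fin n → Bool) → Set
TwoConnected {n} adj =
  (3 ≤ℕ n) × Connected adj ×
  (∀ r x y → x ≢ r → y ≢ r → Walk adj (λ w → w ≢ r) x y)

-- Planarity, via straight-line drawings with rational coordinates
-- (equivalent to topological planarity by Fáry's theorem)

Point : Set
Point = ℚ × ℚ

OnSegment : Point → Point → Point → Set
OnSegment (cx , cy) (ax , ay) (bx , by) =
  Σ ℚ λ l → (0ℚ ≤ℚ l) × (l ≤ℚ 1ℚ) ×
    (cx ≡ ax +ℚ l *ℚ (bx -ℚ ax)) × (cy ≡ ay +ℚ l *ℚ (by -ℚ ay))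

SegmentsMeet : Point → Point → Point → Point → Set
SegmentsMeet a b c d = Σ Point λ z → OnSegment z a b × OnSegment z c d

Planar : ∀ {n} → (Fin n → Fin n → Bool) → Set
Planar {n} adj = Σ (Fin n → Point) λ pos →
  (∀ x y → pos x ≡ pos y → x ≡ y) ×
  (∀ a b c → T (adj a b) → c ≢ a → c ≢ b → ¬ OnSegment (pos c) (pos a) (pos b)) ×
  (∀ a b c d → T (adj a b) → T (adj c d) → a ≢ c → a ≢ d → b ≢ c → b ≢ d →
     ¬ SegmentsMeet (pos a) (pos b) (pos c) (pos d))

-- Ordered perfect matching M = {(mu i , mu' i) | i : Fin k}:
-- every pair is an edge and every vertex is an endpoint of exactly one pair.

matchEnd : ∀ {n k} → (Fin k → Fin n) → (Fin k → Fin n) → Fin k ⊎ Fin k → Fin n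
matchEnd mu mu' (inj₁ i) = mu i
matchEnd mu mu' (inj₂ i) = mu' i

IsOrderedPerfectMatching : ∀ {n k} → (Fin n → Fin n → Bool) → (Fin k → Fin n) → (Fin k → Fin n) → Set
IsOrderedPerfectMatching adj mu mu' =
  (∀ i → T (adj (mu i) (mu' i))) × Bijective _≡_ _≡_ (matchEnd mu mu')

next : ∀ {k} → Fin k → Fin k
next {suc k} i = fromℕ< (m%n<n (suc (toℕ i)) (suc k))

IsVertexCover : ∀ {V : Set} → (V → V → Set) → List V → Set
IsVertexCover {V} E C = ∀ (x y : V) → E x y → x ∈ C ⊎ y ∈ C

HasVertexCoverAtMost : ∀ {V : Set} → (V → V → Set) → ℤ → Set
HasVertexCoverAtMost {V} E p =
  Σ (List V) λ C → Unique C × IsVertexCover E C × (+ length C ≤ℤ p)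

data Side : Set where
  sideU sideV : Side

data G6 : Set where
  gs ga gb gb' ga' gt : G6

-- the 11 gadget edges not touching G_y (y_i s and t y'_i are added in HatYD): sa, ab, bb', b'a', a't, st, tb, ba', a'a, ab', b's
data GadE : G6 → G6 → Set where
  e-sa   : GadE gs ga
  e-ab   : GadE ga gb
  e-bb'  : GadE gb gb'
  e-b'a' : GadE gb' ga'
  e-a't  : GadE ga' gt
  e-st   : GadE gs gt
  e-tb   : GadE gt gb
  e-ba'  : GadE gb ga'
  e-a'a  : GadE ga' ga
  e-ab'  : GadE ga gb'
  e-b's  : GadE gb' gs

HatYV : ℕ → ℕ → Set
HatYV n k = Fin n ⊎ (Fin k × G6)

data G8 : Set where
  gm gn gp gq gm' gn' gp' gq' : G8

data K4E : G8 → G8 → Set where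
  e-mn   : K4E gm gn
  e-mp   : K4E gm gp
  e-mq   : K4E gm gq
  e-np   : K4E gn gp
  e-nq   : K4E gn gq
  e-pq   : K4E gp gq
  e-m'n' : K4E gm' gn'
  e-m'p' : K4E gm' gp'
  e-m'q' : K4E gm' gq'
  e-n'p' : K4E gn' gp'
  e-n'q' : K4E gn' gq'
  e-p'q' : K4E gp' gq'

module _ {n k : ℕ} (adj : Fin n → Fin n → Bool) (mu mu' : Fin k → Fin n) where

  IsMatchingPair : Fin n → Fin n → Set
  IsMatchingPair x y = ∃[ i ] ((x ≡ mu i × y ≡ mu' i) ⊎ (x ≡ mu' i × y ≡ mu i))

  data HatYD : HatYV n k → HatYV n k → Set where
    old  : ∀ x y → T (adj x y) → ¬ IsMatchingPair x y → HatYD (inj₁ x) (inj₁ y)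
    e-ys : ∀ i → HatYD (inj₁ (mu i)) (inj₂ (i , gs))
    e-ty : ∀ i → HatYD (inj₂ (i , gt)) (inj₁ (mu' i))
    gad  : ∀ i {c d} → GadE c d → HatYD (inj₂ (i , c)) (inj₂ (i , d))

  HatYAdj : HatYV n k → HatYV n k → Set
  HatYAdj x y = HatYD x y ⊎ HatYD y x

  HatV : Set
  HatV = Side × HatYV n k

  data HatAdj : HatV → HatV → Set where
    within : ∀ s {x y} → HatYAdj x y → HatAdj (s , x) (s , y)

  TildeV : Set
  TildeV = HatV ⊎ (Fin k × G8)

  data TildeD : TildeV → TildeV → Set where
    hat   : ∀ {x y} → HatAdj x y → TildeD (inj₁ x) (inj₁ y)
    k4    : ∀ i {c d} → K4E c d → TildeD (inj₂ (i , c)) (inj₂ (i , d))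
    e-qp' : ∀ i → TildeD (inj₂ (i , gq)) (inj₂ (i , gp'))
    e-pq' : ∀ i → TildeD (inj₂ (i , gp)) (inj₂ (i , gq'))
    e-u'm : ∀ i → TildeD (inj₁ (sideU , inj₁ (mu' i))) (inj₂ (i , gm))
    e-un' : ∀ i → TildeD (inj₁ (sideU , inj₁ (mu (next i)))) (inj₂ (i , gn'))
    e-v'n : ∀ i → TildeD (inj₁ (sideV , inj₁ (mu' i))) (inj₂ (i , gn))
    e-vm' : ∀ i → TildeD (inj₁ (sideV , inj₁ (mu (next i)))) (inj₂ (i , gm'))

  TildeAdj : TildeV → TildeV → Set
  TildeAdj x y = TildeD x y ⊎ TildeD y x

{-# OPTIONS --safe #-}
-- The 2k = n cliques K₄ added to Ĝ are vertex-disjoint, and a vertex cover of a clique omits at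
-- most one of its vertices, so a cover of G̃ spends at least 3n vertices outside Ĝ; what remains
-- is a cover of Ĝ. Conversely, the 3n gadget vertices other than the pᵢ and p'ᵢ cover every edge
-- of G̃ not in Ĝ, since all neighbours of pᵢ and p'ᵢ are among them.
module Submission where

open import Defs
open import Data.Nat using (ℕ; _*_)
open import Data.Integer using (ℤ; +_; _+_)
open import Data.Fin using (Fin)
open import Data.Bool using (Bool)
open import Function.Bundles using (_⇔_)

open import Data.Nat as ℕ using (suc; _≤_; z≤n; s≤s)
import Data.Nat.Properties as ℕ
import Data.Nat.Tactic.RingSolver as ℕ-Solver
import Data.Integer as ℤ
import Data.Integer.Properties as ℤ
import Data.Integer.Tactic.RingSolver as ℤ-Solver
open import Data.Fin.Properties using (+↔⊎; cantor-schröder-bernstein)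
open import Data.List
  using (List; []; _∷_; _++_; map; concat; concatMap; length; allFin; cartesianProduct)
open import Data.List.Properties using (length-++; length-map; length-tabulate; length-removeAt′)
open import Data.List.Membership.Propositional using (_∈_)
open import Data.List.Membership.Propositional.Properties
  using (∈-++⁺ˡ; ∈-++⁺ʳ; ∈-map⁺; ∈-map⁻; ∈-allFin; ∈-cartesianProduct⁺)
open import Data.List.Relation.Binary.Subset.Propositional using (_⊆_)
open import Data.List.Relation.Binary.Sublist.Propositional
  using ([]; _∷_; _∷ʳ_; ⊆-refl) renaming (_⊆_ to _⊑_)
open import Data.List.Relation.Binary.Sublist.Propositional.Properties
  using (All-resp-⊆) renaming (++⁺ to ⊑-++⁺)
open import Data.List.Relation.Unary.Any using (here; there; _─_)
open import Data.List.Relation.Unary.All as All using (All; []; _∷_)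
import Data.List.Relation.Unary.All.Properties as Allₚ
open import Data.List.Relation.Unary.AllPairs using (AllPairs; []; _∷_)
open import Data.List.Relation.Unary.Unique.Propositional using (Unique)
import Data.List.Relation.Unary.Unique.Propositional.Properties as Uniqueₚ
open import Data.Product using (∃-syntax; _×_; _,_)
open import Data.Sum using (_⊎_; inj₁; inj₂)
import Data.Sum as Sum
open import Data.Sum.Properties using (inj₁-injective; inj₂-injective)
open import Data.Empty using (⊥-elim)
open import Relation.Nullary using (¬_)
open import Function using (id; _∘_; _↔_; Injection; Bijective; mk⤖; mk⇔)
open import Function.Properties.Bijection using (⤖⇒↔)
open import Function.Properties.Inverse using (↔-sym; ↔-trans; ↔⇒↣)
open import Relation.Binary.PropositionalEquality
  using (_≡_; _≢_; refl; sym; trans; cong; cong₂; subst; subst₂; module ≡-Reasoning)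

private
  variable
    A B : Set
    P : A → Set
    x y : A
    xs ys R : List A
    xss : List (List A)

lefts : List (A ⊎ B) → List A
lefts []            = []
lefts (inj₁ a ∷ zs) = a ∷ lefts zs
lefts (inj₂ _ ∷ zs) = lefts zs

rights : List (A ⊎ B) → List B
rights []            = []
rights (inj₁ _ ∷ zs) = rights zs
rights (inj₂ b ∷ zs) = b ∷ rights zs

length-lefts+rights : (zs : List (A ⊎ B)) → length (lefts zs) ℕ.+ length (rights zs) ≡ length zs
length-lefts+rights []            = refl
length-lefts+rights (inj₁ _ ∷ zs) = cong suc (length-lefts+rights zs)
length-lefts+rights (inj₂ _ ∷ zs) =
  trans (ℕ.+-suc (length (lefts zs)) _) (cong suc (length-lefts+rights zs))

∈-lefts⁺ : {zs : List (A ⊎ B)} → inj₁ x ∈ zs → x ∈ lefts zs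
∈-lefts⁺ {zs = inj₁ _ ∷ _} (here refl) = here refl
∈-lefts⁺ {zs = inj₁ _ ∷ _} (there m)   = there (∈-lefts⁺ m)
∈-lefts⁺ {zs = inj₂ _ ∷ _} (there m)   = ∈-lefts⁺ m

∈-rights⁺ : {zs : List (A ⊎ B)} → inj₂ y ∈ zs → y ∈ rights zs
∈-rights⁺ {zs = inj₂ _ ∷ _} (here refl) = here refl
∈-rights⁺ {zs = inj₂ _ ∷ _} (there m)   = there (∈-rights⁺ m)
∈-rights⁺ {zs = inj₁ _ ∷ _} (there m)   = ∈-rights⁺ m

All-lefts : {Q : A ⊎ B → Set} {zs : List (A ⊎ B)} → All Q zs → All (Q ∘ inj₁) (lefts zs)
All-lefts {zs = []}         []       = []
All-lefts {zs = inj₁ _ ∷ _} (q ∷ qs) = q ∷ All-lefts qs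
All-lefts {zs = inj₂ _ ∷ _} (_ ∷ qs) = All-lefts qs

Unique-lefts : {zs : List (A ⊎ B)} → Unique zs → Unique (lefts zs)
Unique-lefts {zs = []}         []       = []
Unique-lefts {zs = inj₁ _ ∷ _} (z∉ ∷ u) =
  All.map (λ z≢ → z≢ ∘ cong inj₁) (All-lefts z∉) ∷ Unique-lefts u
Unique-lefts {zs = inj₂ _ ∷ _} (_ ∷ u)  = Unique-lefts u

Unique-inj₁++inj₂ : {xs : List A} {ys : List B} → Unique xs → Unique ys →
                    Unique (map inj₁ xs ++ map inj₂ ys)
Unique-inj₁++inj₂ {xs = xs} {ys = ys} uxs uys =
  Uniqueₚ.++⁺ (Uniqueₚ.map⁺ inj₁-injective uxs) (Uniqueₚ.map⁺ inj₂-injective uys) disjoint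
  where
  disjoint : ∀ {z} → ¬ (z ∈ map inj₁ xs × z ∈ map inj₂ ys)
  disjoint (z∈₁ , z∈₂) with ∈-map⁻ inj₁ z∈₁ | ∈-map⁻ inj₂ z∈₂
  ... | _ , _ , refl | _ , _ , ()

∈-─⁺ : (x∈ : x ∈ xs) → y ∈ xs → y ≢ x → y ∈ (xs ─ x∈)
∈-─⁺ (here refl) (here refl) y≢x = ⊥-elim (y≢x refl)
∈-─⁺ (here _)    (there y∈)  _   = y∈
∈-─⁺ (there _)   (here refl) _   = here refl
∈-─⁺ (there x∈)  (there y∈)  y≢x = there (∈-─⁺ x∈ y∈ y≢x)

Unique-⊆⇒length≤ : Unique xs → xs ⊆ ys → length xs ≤ length ys
Unique-⊆⇒length≤ []                  _     = z≤n
Unique-⊆⇒length≤ {ys = ys} (x∉ ∷ u) xs⊆ys =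
  subst (_ ≤_) (sym (length-removeAt′ ys _)) (s≤s (Unique-⊆⇒length≤ u tail⊆))
  where
  tail⊆ : _ ⊆ (ys ─ xs⊆ys (here refl))
  tail⊆ y∈ = ∈-─⁺ (xs⊆ys (here refl)) (xs⊆ys (there y∈)) (λ y≡x → All.lookup x∉ y∈ (sym y≡x))

AllPairs-resp-⊑ : {Rel : A → A → Set} → ys ⊑ xs → AllPairs Rel xs → AllPairs Rel ys
AllPairs-resp-⊑ []           []       = []
AllPairs-resp-⊑ (_ ∷ʳ ys⊑)   (_ ∷ h)  = AllPairs-resp-⊑ ys⊑ h
AllPairs-resp-⊑ (refl ∷ ys⊑) (px ∷ h) = All-resp-⊆ ys⊑ px ∷ AllPairs-resp-⊑ ys⊑ h

length-cartesianProduct : (xs : List A) (ys : List B) →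
                          length (cartesianProduct xs ys) ≡ length xs * length ys
length-cartesianProduct []       ys = refl
length-cartesianProduct (x ∷ xs) ys =
  trans (length-++ (map (x ,_) ys))
        (cong₂ ℕ._+_ (length-map (x ,_) ys) (length-cartesianProduct xs ys))

IsCliqueCover : (A → Set) → List A → Set
IsCliqueCover P = AllPairs (λ x y → P x ⊎ P y)

star-cover : All (λ y → P x ⊎ P y) ys → P x ⊎ All P ys
star-cover []             = inj₂ []
star-cover (inj₁ px ∷ _)  = inj₁ px
star-cover (inj₂ py ∷ hs) = Sum.map₂ (py ∷_) (star-cover hs)

clique-cover-⊑ : IsCliqueCover P xs → ∃[ ys ] ys ⊑ xs × All P ys × length xs ≤ suc (length ys)
clique-cover-⊑ [] = [] , [] , [] , z≤n
clique-cover-⊑ {xs = x ∷ xs} (star ∷ h) with star-cover star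
... | inj₁ px  = let ys , ys⊑ , pys , le = clique-cover-⊑ h
                 in x ∷ ys , refl ∷ ys⊑ , px ∷ pys , s≤s le
... | inj₂ pxs = xs , x ∷ʳ ⊆-refl , pxs , ℕ.≤-refl

cliques-cover-⊑ : All (IsCliqueCover P) xss → ∃[ ys ] ys ⊑ concat xss × All P ys ×
                                              length (concat xss) ≤ length xss ℕ.+ length ys
cliques-cover-⊑ [] = [] , [] , [] , z≤n
cliques-cover-⊑ {xss = xs ∷ xss} (h ∷ hs) =
  let ys₁ , ys₁⊑ , pys₁ , le₁ = clique-cover-⊑ h
      ys₂ , ys₂⊑ , pys₂ , le₂ = cliques-cover-⊑ hs
  in ys₁ ++ ys₂ , ⊑-++⁺ ys₁⊑ ys₂⊑ , Allₚ.++⁺ pys₁ pys₂ , (begin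
       length (xs ++ concat xss)                        ≡⟨ length-++ xs ⟩
       length xs ℕ.+ length (concat xss)                ≤⟨ ℕ.+-mono-≤ le₁ le₂ ⟩
       suc (length ys₁) ℕ.+ (length xss ℕ.+ length ys₂) ≡⟨ rearrange (length ys₁) (length xss) _ ⟩
       suc (length xss) ℕ.+ (length ys₁ ℕ.+ length ys₂) ≡⟨ cong (suc _ ℕ.+_) (length-++ ys₁) ⟨
       suc (length xss) ℕ.+ length (ys₁ ++ ys₂)         ∎)
  where
  open ℕ.≤-Reasoning
  rearrange : ∀ a b c → suc a ℕ.+ (b ℕ.+ c) ≡ suc b ℕ.+ (a ℕ.+ c)
  rearrange = ℕ-Solver.solve-∀

cover-of-disjoint-cliques : Unique (concat xss) → All (IsCliqueCover (_∈ R)) xss →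
                            length (concat xss) ≤ length xss ℕ.+ length R
cover-of-disjoint-cliques u hs =
  let ys , ys⊑ , ys⊆R , le = cliques-cover-⊑ hs
  in ℕ.≤-trans le (ℕ.+-monoʳ-≤ _ (Unique-⊆⇒length≤ (AllPairs-resp-⊑ ys⊑ u) (All.lookup ys⊆R)))

length-allFin : ∀ k → length (allFin k) ≡ k
length-allFin k = length-tabulate {n = k} id

Fin-↔⇒≡ : ∀ {m n} → Fin m ↔ Fin n → m ≡ n
Fin-↔⇒≡ m↔n = cantor-schröder-bernstein (Injection.injective (↔⇒↣ m↔n))
                                        (Injection.injective (↔⇒↣ (↔-sym m↔n)))

perfect-matching-size : ∀ {n k} (mu mu' : Fin k → Fin n) →
                        Bijective _≡_ _≡_ (matchEnd mu mu') → k ℕ.+ k ≡ n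
perfect-matching-size _ _ bij = Fin-↔⇒≡ (↔-trans +↔⊎ (⤖⇒↔ (mk⤖ bij)))

gadget-size : ∀ k {n} → k ℕ.+ k ≡ n → k * 6 ≡ 3 * n
gadget-size k refl = lemma k
  where
  lemma : ∀ k → k * 6 ≡ 3 * (k ℕ.+ k)
  lemma = ℕ-Solver.solve-∀

+-cancelʳ-≤ : ∀ {i j} k → i + k ℤ.≤ j + k → i ℤ.≤ j
+-cancelʳ-≤ {i} {j} k le = subst₂ ℤ._≤_ (cancel i k) (cancel j k) (ℤ.+-monoˡ-≤ (ℤ.- k) le)
  where
  cancel : ∀ x k → x + k ℤ.- k ≡ x
  cancel = ℤ-Solver.solve-∀

K₄ K₄' : List G8
K₄  = gm  ∷ gn  ∷ gp  ∷ gq  ∷ []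
K₄' = gm' ∷ gn' ∷ gp' ∷ gq' ∷ []

Unique-K₄++K₄' : Unique (K₄ ++ K₄')
Unique-K₄++K₄' =
  ((λ ()) ∷ (λ ()) ∷ (λ ()) ∷ (λ ()) ∷ (λ ()) ∷ (λ ()) ∷ (λ ()) ∷ []) ∷
  ((λ ()) ∷ (λ ()) ∷ (λ ()) ∷ (λ ()) ∷ (λ ()) ∷ (λ ()) ∷ []) ∷
  ((λ ()) ∷ (λ ()) ∷ (λ ()) ∷ (λ ()) ∷ (λ ()) ∷ []) ∷
  ((λ ()) ∷ (λ ()) ∷ (λ ()) ∷ (λ ()) ∷ []) ∷
  ((λ ()) ∷ (λ ()) ∷ (λ ()) ∷ []) ∷
  ((λ ()) ∷ (λ ()) ∷ []) ∷
  ((λ ()) ∷ []) ∷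
  [] ∷ []

gadgetCover : List G8
gadgetCover = gm ∷ gn ∷ gq ∷ gm' ∷ gn' ∷ gq' ∷ []

gadgetCover⊑K₄++K₄' : gadgetCover ⊑ K₄ ++ K₄'
gadgetCover⊑K₄++K₄' = refl ∷ refl ∷ gp ∷ʳ refl ∷ refl ∷ refl ∷ gp' ∷ʳ refl ∷ []

m∈gadgetCover : gm ∈ gadgetCover
m∈gadgetCover = here refl

n∈gadgetCover : gn ∈ gadgetCover
n∈gadgetCover = there (here refl)

q∈gadgetCover : gq ∈ gadgetCover
q∈gadgetCover = there (there (here refl))

m'∈gadgetCover : gm' ∈ gadgetCover
m'∈gadgetCover = there (there (there (here refl)))

n'∈gadgetCover : gn' ∈ gadgetCover
n'∈gadgetCover = there (there (there (there (here refl))))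

q'∈gadgetCover : gq' ∈ gadgetCover
q'∈gadgetCover = there (there (there (there (there (here refl)))))

K4E-gadgetCover : ∀ {c d} → K4E c d → c ∈ gadgetCover ⊎ d ∈ gadgetCover
K4E-gadgetCover e-mn   = inj₁ m∈gadgetCover
K4E-gadgetCover e-mp   = inj₁ m∈gadgetCover
K4E-gadgetCover e-mq   = inj₁ m∈gadgetCover
K4E-gadgetCover e-np   = inj₁ n∈gadgetCover
K4E-gadgetCover e-nq   = inj₁ n∈gadgetCover
K4E-gadgetCover e-pq   = inj₂ q∈gadgetCover
K4E-gadgetCover e-m'n' = inj₁ m'∈gadgetCover
K4E-gadgetCover e-m'p' = inj₁ m'∈gadgetCover
K4E-gadgetCover e-m'q' = inj₁ m'∈gadgetCover
K4E-gadgetCover e-n'p' = inj₁ n'∈gadgetCover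
K4E-gadgetCover e-n'q' = inj₁ n'∈gadgetCover
K4E-gadgetCover e-p'q' = inj₂ q'∈gadgetCover

module _ {k : ℕ} where

  gadgetCliques : Fin k → List (List (Fin k × G8))
  gadgetCliques i = map (i ,_) K₄ ∷ map (i ,_) K₄' ∷ []

  concat-gadgetCliques : (is : List (Fin k)) →
                         concat (concatMap gadgetCliques is) ≡ cartesianProduct is (K₄ ++ K₄')
  concat-gadgetCliques []       = refl
  concat-gadgetCliques (i ∷ is) = cong (map (i ,_) (K₄ ++ K₄') ++_) (concat-gadgetCliques is)

  length-gadgetCliques : (is : List (Fin k)) → length (concatMap gadgetCliques is) ≡ length is * 2
  length-gadgetCliques []       = refl
  length-gadgetCliques (i ∷ is) = cong (2 ℕ.+_) (length-gadgetCliques is)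

  gadgetCliques-covered : {Q : Fin k × G8 → Set} →
                          (∀ i {c d} → K4E c d → Q (i , c) ⊎ Q (i , d)) →
                          (is : List (Fin k)) → All (IsCliqueCover Q) (concatMap gadgetCliques is)
  gadgetCliques-covered e []       = []
  gadgetCliques-covered e (i ∷ is) =
    ((e i e-mn ∷ e i e-mp ∷ e i e-mq ∷ []) ∷ (e i e-np ∷ e i e-nq ∷ []) ∷ (e i e-pq ∷ []) ∷ [] ∷ [])
    ∷ ((e i e-m'n' ∷ e i e-m'p' ∷ e i e-m'q' ∷ []) ∷ (e i e-n'p' ∷ e i e-n'q' ∷ [])
         ∷ (e i e-p'q' ∷ []) ∷ [] ∷ [])
    ∷ gadgetCliques-covered e is

  gadget-cover-size : (R : List (Fin k × G8)) →
                      (∀ i {c d} → K4E c d → (i , c) ∈ R ⊎ (i , d) ∈ R) → k * 6 ≤ length R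
  gadget-cover-size R covers = ℕ.+-cancelˡ-≤ (k * 2) _ _ (begin
    k * 2 ℕ.+ k * 6                ≡⟨ sym (ℕ.*-distribˡ-+ k 2 6) ⟩
    k * 8                          ≡⟨ sym length-vertices ⟩
    length (concat cliques)        ≤⟨ cover-of-disjoint-cliques unique covered ⟩
    length cliques ℕ.+ length R    ≡⟨ cong (ℕ._+ length R) length-cliques ⟩
    k * 2 ℕ.+ length R             ∎)
    where
    open ℕ.≤-Reasoning
    cliques : List (List (Fin k × G8))
    cliques = concatMap gadgetCliques (allFin k)
    covered : All (IsCliqueCover (_∈ R)) cliques
    covered = gadgetCliques-covered covers (allFin k)
    unique : Unique (concat cliques)
    unique = subst Unique (sym (concat-gadgetCliques (allFin k)))
                   (Uniqueₚ.cartesianProduct⁺ (Uniqueₚ.allFin⁺ k) Unique-K₄++K₄')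
    length-vertices : length (concat cliques) ≡ k * 8
    length-vertices = begin-equality
      length (concat cliques)                          ≡⟨ cong length (concat-gadgetCliques (allFin k)) ⟩
      length (cartesianProduct (allFin k) (K₄ ++ K₄')) ≡⟨ length-cartesianProduct (allFin k) _ ⟩
      length (allFin k) * 8                            ≡⟨ cong (_* 8) (length-allFin k) ⟩
      k * 8                                            ∎
    length-cliques : length cliques ≡ k * 2
    length-cliques = trans (length-gadgetCliques (allFin k)) (cong (_* 2) (length-allFin k))

module _ {n k : ℕ} (adj : Fin n → Fin n → Bool) (mu mu' : Fin k → Fin n) where

  gadgetCoverVertices : List (Fin k × G8)
  gadgetCoverVertices = cartesianProduct (allFin k) gadgetCover

  Unique-gadgetCoverVertices : Unique gadgetCoverVertices
  Unique-gadgetCoverVertices = Uniqueₚ.cartesianProduct⁺ (Uniqueₚ.allFin⁺ k)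
    (AllPairs-resp-⊑ gadgetCover⊑K₄++K₄' Unique-K₄++K₄')

  length-gadgetCoverVertices : length gadgetCoverVertices ≡ k * 6
  length-gadgetCoverVertices =
    trans (length-cartesianProduct (allFin k) gadgetCover) (cong (_* 6) (length-allFin k))

  extendCover : List (HatV adj mu mu') → List (TildeV adj mu mu')
  extendCover C = map inj₁ C ++ map inj₂ gadgetCoverVertices

  Unique-extendCover : ∀ {C} → Unique C → Unique (extendCover C)
  Unique-extendCover uC = Unique-inj₁++inj₂ uC Unique-gadgetCoverVertices

  extendCover-isVertexCover : ∀ {C} → IsVertexCover (HatAdj adj mu mu') C →
                              IsVertexCover (TildeAdj adj mu mu') (extendCover C)
  extendCover-isVertexCover {C} cover _ _ (inj₁ e) = covers e
    where
    fromHat : ∀ {x} → x ∈ C → inj₁ x ∈ extendCover C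
    fromHat = ∈-++⁺ˡ ∘ ∈-map⁺ inj₁
    fromGadget : ∀ i {g} → g ∈ gadgetCover → inj₂ (i , g) ∈ extendCover C
    fromGadget i = ∈-++⁺ʳ (map inj₁ C) ∘ ∈-map⁺ inj₂ ∘ ∈-cartesianProduct⁺ (∈-allFin i)
    covers : ∀ {x y} → TildeD adj mu mu' x y → x ∈ extendCover C ⊎ y ∈ extendCover C
    covers (hat e)   = Sum.map fromHat fromHat (cover _ _ e)
    covers (k4 i e)  = Sum.map (fromGadget i) (fromGadget i) (K4E-gadgetCover e)
    covers (e-qp' i) = inj₁ (fromGadget i q∈gadgetCover)
    covers (e-pq' i) = inj₂ (fromGadget i q'∈gadgetCover)
    covers (e-u'm i) = inj₂ (fromGadget i m∈gadgetCover)
    covers (e-un' i) = inj₂ (fromGadget i n'∈gadgetCover)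
    covers (e-v'n i) = inj₂ (fromGadget i n∈gadgetCover)
    covers (e-vm' i) = inj₂ (fromGadget i m'∈gadgetCover)
  extendCover-isVertexCover cover x y (inj₂ e) =
    Sum.swap (extendCover-isVertexCover cover y x (inj₁ e))

  lefts-isVertexCover : ∀ {C} → IsVertexCover (TildeAdj adj mu mu') C →
                        IsVertexCover (HatAdj adj mu mu') (lefts C)
  lefts-isVertexCover cover x y e =
    Sum.map ∈-lefts⁺ ∈-lefts⁺ (cover (inj₁ x) (inj₁ y) (inj₁ (hat e)))

  module _ (gadget-size≡ : k * 6 ≡ 3 * n) where

    length-extendCover : ∀ C → length (extendCover C) ≡ length C ℕ.+ 3 * n
    length-extendCover C = begin
      length (extendCover C)                                        ≡⟨ length-++ (map inj₁ C) ⟩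
      length (map inj₁ C) ℕ.+ length (map inj₂ gadgetCoverVertices) ≡⟨ cong₂ ℕ._+_ (length-map inj₁ C)
                                                                                    length-gadget ⟩
      length C ℕ.+ 3 * n                                            ∎
      where
      open ≡-Reasoning
      length-gadget : length (map (inj₂ {A = HatV adj mu mu'}) gadgetCoverVertices) ≡ 3 * n
      length-gadget =
        trans (length-map inj₂ gadgetCoverVertices) (trans length-gadgetCoverVertices gadget-size≡)

    rights-size : ∀ {C} → IsVertexCover (TildeAdj adj mu mu') C → 3 * n ≤ length (rights C)
    rights-size {C} cover = subst (_≤ length (rights C)) gadget-size≡
      (gadget-cover-size (rights C) λ i e → Sum.map ∈-rights⁺ ∈-rights⁺ (cover _ _ (inj₁ (k4 i e))))

    extend : ∀ {p} → HasVertexCoverAtMost (HatAdj adj mu mu') p →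
             HasVertexCoverAtMost (TildeAdj adj mu mu') (p + + (3 * n))
    extend {p} (C , uC , cover , |C|≤p) =
      extendCover C , Unique-extendCover uC , extendCover-isVertexCover cover , (begin
        + length (extendCover C) ≡⟨ cong +_ (length-extendCover C) ⟩
        + length C + + (3 * n)   ≤⟨ ℤ.+-monoˡ-≤ (+ (3 * n)) |C|≤p ⟩
        p + + (3 * n)            ∎)
      where open ℤ.≤-Reasoning

    restrict : ∀ {p} → HasVertexCoverAtMost (TildeAdj adj mu mu') (p + + (3 * n)) →
               HasVertexCoverAtMost (HatAdj adj mu mu') p
    restrict {p} (C , uC , cover , |C|≤p+3n) =
      lefts C , Unique-lefts uC , lefts-isVertexCover cover , +-cancelʳ-≤ (+ (3 * n)) (begin
        + length (lefts C) + + (3 * n)             ≤⟨ ℤ.+≤+ (ℕ.+-monoʳ-≤ _ (rights-size cover)) ⟩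
        + (length (lefts C) ℕ.+ length (rights C)) ≡⟨ cong +_ (length-lefts+rights C) ⟩
        + length C                                 ≤⟨ |C|≤p+3n ⟩
        p + + (3 * n)                              ∎)
      where open ℤ.≤-Reasoning

mainTheorem6 : (n k : ℕ) (adj : Fin n → Fin n → Bool) →
    IsSimple adj → Cubic adj → TwoConnected adj → Planar adj →
    (mu mu' : Fin k → Fin n) → IsOrderedPerfectMatching adj mu mu' →
    (p : ℤ) →
    HasVertexCoverAtMost (HatAdj adj mu mu') p
      ⇔ HasVertexCoverAtMost (TildeAdj adj mu mu') (p + + (3 * n))
mainTheorem6 n k adj _ _ _ _ mu mu' (_ , bijective) p =
  mk⇔ (extend adj mu mu' size) (restrict adj mu mu' size)
  where
  size : k * 6 ≡ 3 * n
  size = gadget-size k (perfect-matching-size mu mu' bijective)
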